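{- If $\beta\le_{\mathcal{O}}\alpha$ are notations in Kleene's $\mathcal{O}$, then there is a unique minimal $\mathcal{O}$-path from $\alpha$ to $\beta$. Moreover, if $\delta$ is the minimal $\mathcal{O}$-path from $\alpha$ to $\beta$, then for every $n$ with $0<n\le|\delta|$, $\delta\restriction n$ is the minimal $\mathcal{O}$-path from $\alpha$ to $\delta(n-1)$.
   Context: For a limit notation $\lambda$, $\lambda_{\mathcal{O}}(n)$ denotes the $n$-th element of the effectively given $<_{\mathcal{O}}$-increasing sequence defining $\lambda$. An $\mathcal{O}$-path from $\alpha$ to $\beta$ is a nonempty string $\delta$ of notations with $\delta(0)=\alpha$, $\delta(|\delta|-1)=\beta$, and for all $n$ with $n+1<|\delta|$: if $\delta(n)=\kappa+1$ then $\delta(n+1)=\kappa$; if $\delta(n)=\lambda$ is not a successor notation then $\delta(n+1)$ is in the range of $\lambda_{\mathcal{O}}$. It is minimal if in the latter case $\delta(n+1)$ is required to be the $<_{\mathcal{O}}$-least element $\gamma$ of the range of $\lambda_{\mathcal{O}}$ with $\beta\le_{\mathcal{O}}\gamma$. -}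

module Defs where

open import Data.Nat using (ℕ; zero; suc; _+_; _*_; _∸_; _^_; _<_; _≤_)
open import Data.List using (List; []; _∷_; length; take)
open import Data.Maybe using (Maybe; just; nothing)
open import Data.Product using (Σ; ∃; _×_; _,_)
open import Data.Sum using (_⊎_)
open import Relation.Binary.PropositionalEquality using (_≡_)

-- An enumeration of partial (computable) functions φ_e, given by its graph:
-- φ e n m  means  "φ_e(n) is defined and equals m".
record Enumeration : Set₁ where
  field
    φ          : ℕ → ℕ → ℕ → Set
    functional : ∀ {e n m m'} → φ e n m → φ e n m' → m ≡ m'

nth : List ℕ → ℕ → Maybe ℕ
nth []       _       = nothing
nth (x ∷ xs) zero    = just x
nth (x ∷ xs) (suc n) = nth xs n

module Kleene (E : Enumeration) where
  open Enumeration E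

  -- Kleene's standard coding: 1 is the notation for 0,
  -- 2^a is the successor notation a+1, 3·5^e is the limit notation
  -- with fundamental sequence φ_e.
  succN : ℕ → ℕ
  succN a = 2 ^ a

  limN : ℕ → ℕ
  limN e = 3 * 5 ^ e

  data Notation : ℕ → Set
  data _<O_ : ℕ → ℕ → Set

  data Notation where
    one : Notation 1
    suc : ∀ {a} → Notation a → Notation (succN a)
    lim : ∀ {e} → (∀ n → ∃ λ m → φ e n m)
                → (∀ n m m' → φ e n m → φ e (suc n) m' → m <O m')
                → Notation (limN e)

  data _<O_ where
    <suc   : ∀ {a} → Notation a → a <O succN a
    <lim   : ∀ {e n m} → Notation (limN e) → φ e n m → m <O limN e
    <trans : ∀ {a b c} → a <O b → b <O c → a <O c

  _≤O_ : ℕ → ℕ → Set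
  a ≤O b = a <O b ⊎ a ≡ b

  InRange : ℕ → ℕ → Set
  InRange e γ = ∃ λ n → φ e n γ

  Step : ℕ → ℕ → Set
  Step x y = (Σ ℕ λ κ → x ≡ succN κ × y ≡ κ)
           ⊎ (Σ ℕ λ e → x ≡ limN e × InRange e y)

  MinStep : ℕ → ℕ → ℕ → Set
  MinStep β x y = (Σ ℕ λ κ → x ≡ succN κ × y ≡ κ)
                ⊎ (Σ ℕ λ e → x ≡ limN e × InRange e y × β ≤O y
                     × (∀ γ → InRange e γ → β ≤O γ → y ≤O γ))

  PathWith : (ℕ → ℕ → Set) → ℕ → ℕ → List ℕ → Set
  PathWith R α β δ =
      0 < length δ
    × (∀ n x → nth δ n ≡ just x → Notation x)
    × nth δ 0 ≡ just α
    × nth δ (length δ ∸ 1) ≡ just β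
    × (∀ n x y → nth δ n ≡ just x → nth δ (suc n) ≡ just y → R x y)

  OPath : ℕ → ℕ → List ℕ → Set
  OPath = PathWith Step

  MinOPath : ℕ → ℕ → List ℕ → Set
  MinOPath α β = PathWith (MinStep β) α β

{-# OPTIONS --safe #-}
module Submission where

-- Every step of an O-path strictly decreases in <_O, and <_O is well founded on
-- notations, so a minimal path towards β is built by well-founded recursion on α:
-- at a limit λ the fundamental sequence is <_O-increasing, so the least n with
-- β ≤_O λ_O(n) gives the <_O-least admissible entry (found with excluded middle).
-- Minimal steps are functional, which gives uniqueness. A minimal step towards β
-- that lands at or above some x ≥_O β is also a minimal step towards x, so
-- prefixes of minimal paths are minimal.

open import Defs
open import Level using (0ℓ)
open import Axiom.ExcludedMiddle using (ExcludedMiddle)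
open import Data.Nat
open import Data.Nat.Properties
open import Data.Nat.DivMod using (_%_; %-distribˡ-*; m*n%n≡0)
open import Data.Nat.Induction using (<-rec)
open import Data.List using (List; []; _∷_; length; take)
open import Data.Maybe using (just)
open import Data.Maybe.Properties using (just-injective)
open import Data.Product using (Σ; ∃; ∃₂; _×_; _,_; proj₁; proj₂; map₂)
open import Data.Sum using (inj₁; inj₂)
open import Data.Empty using (⊥-elim)
open import Function using (case_of_)
open import Induction.WellFounded using (Acc; acc; acc-inverse; acc⇒asym)
open import Relation.Binary using (tri<; tri≈; tri>)
open import Relation.Nullary using (¬_; yes; no)
open import Relation.Binary.PropositionalEquality

^-injectiveʳ : ∀ m {a b} → 1 < m → m ^ a ≡ m ^ b → a ≡ b
^-injectiveʳ m {a} {b} 1<m eq with <-cmp a b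
... | tri< a<b _ _ = ⊥-elim (<-irrefl eq (^-monoʳ-< m 1<m a<b))
... | tri≈ _ a≡b _ = a≡b
... | tri> _ _ b<a = ⊥-elim (<-irrefl (sym eq) (^-monoʳ-< m 1<m b<a))

module Codes (E : Enumeration) where
  open Kleene E

  succN-injective : ∀ a b → succN a ≡ succN b → a ≡ b
  succN-injective a b = ^-injectiveʳ 2 (s≤s (s≤s z≤n))

  limN-injective : ∀ e e′ → limN e ≡ limN e′ → e ≡ e′
  limN-injective e e′ eq = ^-injectiveʳ 5 (s≤s (s≤s z≤n)) (*-cancelˡ-≡ (5 ^ e) (5 ^ e′) 3 eq)

  limN≥3 : ∀ e → 3 ≤ limN e
  limN≥3 e = m≤m*n 3 (5 ^ e) {{m^n≢0 5 e}}

  limN-odd : ∀ e → limN e % 2 ≡ 1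
  limN-odd zero = refl
  limN-odd (suc e) = begin
    3 * (5 * 5 ^ e) % 2     ≡⟨ cong (λ n → 3 * n % 2) (*-comm 5 (5 ^ e)) ⟩
    3 * (5 ^ e * 5) % 2     ≡⟨ cong (_% 2) (sym (*-assoc 3 (5 ^ e) 5)) ⟩
    limN e * 5 % 2          ≡⟨ %-distribˡ-* (limN e) 5 2 ⟩
    limN e % 2 * 1 % 2      ≡⟨ cong (λ r → r * 1 % 2) (limN-odd e) ⟩
    1                       ∎
    where open ≡-Reasoning

  succN≢limN : ∀ a e → succN a ≢ limN e
  succN≢limN zero e eq = <⇒≢ (≤-trans (s≤s (s≤s z≤n)) (limN≥3 e)) eq
  succN≢limN (suc a) e eq = 0≢1+n (begin
    0                 ≡⟨ sym (m*n%n≡0 (2 ^ a) 2) ⟩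
    2 ^ a * 2 % 2     ≡⟨ cong (_% 2) (*-comm (2 ^ a) 2) ⟩
    succN (suc a) % 2 ≡⟨ cong (_% 2) eq ⟩
    limN e % 2        ≡⟨ limN-odd e ⟩
    1                 ∎)
    where open ≡-Reasoning

least-satisfying : ExcludedMiddle 0ℓ → (Q : ℕ → Set) →
                   ∀ n → Q n → ∃ λ m → Q m × (∀ {k} → k < m → ¬ Q k)
least-satisfying em Q = <-rec _ λ n smaller Qn →
  case em {∃ λ k → k < n × Q k} of λ where
    (yes (k , k<n , Qk)) → smaller k<n Qk
    (no none)            → n , Qn , λ {k} k<n Qk → none (k , k<n , Qk)

module Properties (E : Enumeration) where
  open Enumeration E
  open Kleene E
  open Codes E

  ≤O-trans : ∀ {a b c} → a ≤O b → b ≤O c → a ≤O c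
  ≤O-trans (inj₁ a<b) (inj₁ b<c) = inj₁ (<trans a<b b<c)
  ≤O-trans (inj₁ a<b) (inj₂ refl) = inj₁ a<b
  ≤O-trans (inj₂ refl) b≤c = b≤c

  <O-≤O-trans : ∀ {a b c} → a <O b → b ≤O c → a <O c
  <O-≤O-trans a<b (inj₁ b<c) = <trans a<b b<c
  <O-≤O-trans a<b (inj₂ refl) = a<b

  ≤O-<O-trans : ∀ {a b c} → a ≤O b → b <O c → a <O c
  ≤O-<O-trans (inj₁ a<b) b<c = <trans a<b b<c
  ≤O-<O-trans (inj₂ refl) b<c = b<c

  ≤O-monotone : (s : ℕ → ℕ) → (∀ n → s n <O s (suc n)) → ∀ {n k} → n ≤′ k → s n ≤O s k
  ≤O-monotone s increasing ≤′-refl = inj₂ refl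
  ≤O-monotone s increasing (≤′-step n≤k) =
    ≤O-trans (≤O-monotone s increasing n≤k) (inj₁ (increasing _))

  <succN⇒≤O : ∀ {x y a} → x <O y → y ≡ succN a → x ≤O a
  <succN⇒≤O {a = a} (<suc {a′} _) eq with succN-injective a′ a eq
  ... | refl = inj₂ refl
  <succN⇒≤O {a = a} (<lim {e} _ _) eq = ⊥-elim (succN≢limN a e (sym eq))
  <succN⇒≤O (<trans x<z z<y) eq = inj₁ (<O-≤O-trans x<z (<succN⇒≤O z<y eq))

  <limN⇒≤O-range : ∀ {x y e} → x <O y → y ≡ limN e → ∃₂ λ n m → φ e n m × x ≤O m
  <limN⇒≤O-range {e = e} (<suc {a} _) eq = ⊥-elim (succN≢limN a e eq)
  <limN⇒≤O-range {e = e} (<lim {e′} {n} {m} _ φnm) eq with limN-injective e′ e eq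
  ... | refl = n , m , φnm , inj₂ refl
  <limN⇒≤O-range (<trans x<z z<y) eq with <limN⇒≤O-range z<y eq
  ... | n , m , φnm , z≤m = n , m , φnm , inj₁ (<O-≤O-trans x<z z≤m)

  mutual
    <O⇒Notationˡ : ∀ {x y} → x <O y → Notation x
    <O⇒Notationˡ (<suc na) = na
    <O⇒Notationˡ (<lim nλ φnm) = range-Notation nλ refl φnm
    <O⇒Notationˡ (<trans x<z _) = <O⇒Notationˡ x<z

    range-Notation : ∀ {z e n m} → Notation z → z ≡ limN e → φ e n m → Notation m
    range-Notation {e = e} one eq _ = ⊥-elim (succN≢limN 0 e eq)
    range-Notation {e = e} (suc {a} _) eq _ = ⊥-elim (succN≢limN a e eq)
    range-Notation {e = e} {n} (lim {e′} f increasing) eq φnm with limN-injective e′ e eq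
    ... | refl = <O⇒Notationˡ (increasing n _ _ φnm (proj₂ (f (suc n))))

  <O⇒Notationʳ : ∀ {x y} → x <O y → Notation y
  <O⇒Notationʳ (<suc na) = suc na
  <O⇒Notationʳ (<lim nλ _) = nλ
  <O⇒Notationʳ (<trans _ z<y) = <O⇒Notationʳ z<y

  Notation⇒>0 : ∀ {z} → Notation z → 0 < z
  Notation⇒>0 one = s≤s z≤n
  Notation⇒>0 (suc {a} _) = m^n>0 2 a
  Notation⇒>0 (lim {e} _ _) = ≤-trans (s≤s z≤n) (limN≥3 e)

  -- 1 = succN 0 is the notation for the ordinal 0.
  ≮O1 : ∀ {x} → ¬ x <O 1
  ≮O1 x<1 with <succN⇒≤O {a = 0} x<1 refl
  ... | inj₁ x<0 = <-irrefl refl (Notation⇒>0 (<O⇒Notationʳ x<0))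
  ... | inj₂ refl = <-irrefl refl (Notation⇒>0 (<O⇒Notationˡ x<1))

  ≤O-Acc : ∀ {x y} → Acc _<O_ y → x ≤O y → Acc _<O_ x
  ≤O-Acc acc-y (inj₁ x<y) = acc-inverse acc-y x<y
  ≤O-Acc acc-y (inj₂ refl) = acc-y

  mutual
    Notation⇒Acc : ∀ {y} → Notation y → Acc _<O_ y
    Notation⇒Acc one = acc λ x<1 → ⊥-elim (≮O1 x<1)
    Notation⇒Acc (suc na) = acc λ x<y → ≤O-Acc (Notation⇒Acc na) (<succN⇒≤O x<y refl)
    Notation⇒Acc (lim f increasing) = acc λ x<y → case <limN⇒≤O-range x<y refl of λ where
      (n , m , φnm , x≤m) → ≤O-Acc (<O⇒Accˡ (increasing n m _ φnm (proj₂ (f (suc n))))) x≤m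

    <O⇒Accˡ : ∀ {x y} → x <O y → Acc _<O_ x
    <O⇒Accˡ (<suc na) = Notation⇒Acc na
    <O⇒Accˡ (<lim nλ φnm) = acc-inverse (Notation⇒Acc nλ) (<lim nλ φnm)
    <O⇒Accˡ (<trans x<z _) = <O⇒Accˡ x<z

  <O-irrefl : ∀ {x} → ¬ x <O x
  <O-irrefl x<x = acc⇒asym (<O⇒Accˡ x<x) x<x x<x

  ≤O-antisym : ∀ {x y} → x ≤O y → y ≤O x → x ≡ y
  ≤O-antisym (inj₂ x≡y) _ = x≡y
  ≤O-antisym (inj₁ _) (inj₂ y≡x) = sym y≡x
  ≤O-antisym (inj₁ x<y) (inj₁ y<x) = ⊥-elim (<O-irrefl (<trans x<y y<x))

  Step⇒<O : ∀ {x y} → Step x y → Notation x → Notation y → y <O x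
  Step⇒<O (inj₁ (_ , refl , refl)) _ ny = <suc ny
  Step⇒<O (inj₂ (_ , refl , (_ , φny))) nx _ = <lim nx φny

  MinStep⇒Step : ∀ {β x y} → MinStep β x y → Step x y
  MinStep⇒Step (inj₁ s) = inj₁ s
  MinStep⇒Step (inj₂ (e , x≡λ , y∈range , _)) = inj₂ (e , x≡λ , y∈range)

  MinStep-functional : ∀ {β x y y′} → MinStep β x y → MinStep β x y′ → y ≡ y′
  MinStep-functional (inj₁ (κ , refl , refl)) (inj₁ (κ′ , x≡ , refl)) = succN-injective κ κ′ x≡
  MinStep-functional (inj₁ (κ , refl , _)) (inj₂ (e , x≡ , _)) = ⊥-elim (succN≢limN κ e x≡)
  MinStep-functional (inj₂ (e , refl , _)) (inj₁ (κ , x≡ , _)) = ⊥-elim (succN≢limN κ e (sym x≡))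
  MinStep-functional (inj₂ (e , refl , y∈ , β≤y , y-least)) (inj₂ (e′ , x≡ , y′∈ , β≤y′ , y′-least))
    with limN-injective e e′ x≡
  ... | refl = ≤O-antisym (y-least _ y′∈ β≤y′) (y′-least _ y∈ β≤y)

  MinStep-retarget : ∀ {β x α y} → MinStep β α y → β ≤O x → x ≤O y → MinStep x α y
  MinStep-retarget (inj₁ s) _ _ = inj₁ s
  MinStep-retarget (inj₂ (e , α≡λ , y∈ , _ , y-least)) β≤x x≤y =
    inj₂ (e , α≡λ , y∈ , x≤y , λ γ γ∈ x≤γ → y-least γ γ∈ (≤O-trans β≤x x≤γ))

  module _ {e} (f : ∀ n → ∃ λ m → φ e n m)
               (increasing : ∀ n m m′ → φ e n m → φ e (suc n) m′ → m <O m′) where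

    λ-seq : ℕ → ℕ
    λ-seq n = proj₁ (f n)

    least-MinStep : ∀ {β n} → β ≤O λ-seq n → (∀ {k} → k < n → ¬ β ≤O λ-seq k) →
                    MinStep β (limN e) (λ-seq n)
    least-MinStep {β} {n} β≤λn below = inj₂ (e , refl , (n , proj₂ (f n)) , β≤λn , λ-n-least)
      where
        λ-seq-monotone : ∀ {n k} → n ≤′ k → λ-seq n ≤O λ-seq k
        λ-seq-monotone = ≤O-monotone λ-seq λ k → increasing k _ _ (proj₂ (f k)) (proj₂ (f (suc k)))

        λ-n-least : ∀ γ → InRange e γ → β ≤O γ → λ-seq n ≤O γ
        λ-n-least γ (k , φkγ) β≤γ rewrite functional φkγ (proj₂ (f k)) =
          λ-seq-monotone (≤⇒≤′ (≮⇒≥ λ k<n → below k<n β≤γ))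

  MinStep-exists : ExcludedMiddle 0ℓ → ∀ {α β} → Notation α → β <O α →
                   ∃ λ γ → MinStep β α γ × γ <O α × β ≤O γ
  MinStep-exists em one β<1 = ⊥-elim (≮O1 β<1)
  MinStep-exists em (suc {a} na) β<α = a , inj₁ (a , refl , refl) , <suc na , <succN⇒≤O β<α refl
  MinStep-exists em {β = β} (lim f increasing) β<α
    with <limN⇒≤O-range β<α refl
  ... | n₀ , m , φn₀m , β≤m with functional φn₀m (proj₂ (f n₀))
  ... | refl with least-satisfying em (λ k → β ≤O proj₁ (f k)) n₀ β≤m
  ... | n , β≤λn , below =
    proj₁ (f n) , least-MinStep f increasing β≤λn below , <lim (lim f increasing) (proj₂ (f n)) , β≤λn

  module _ (R : ℕ → ℕ → Set) where

    infixr 5 _∷⟨_⟩_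
    data Path : ℕ → ℕ → List ℕ → Set where
      [_]     : ∀ {α} → Notation α → Path α α (α ∷ [])
      _∷⟨_⟩_ : ∀ {α x β δ} → Notation α → R α x → Path x β δ → Path α β (α ∷ δ)

  module _ {R : ℕ → ℕ → Set} where

    Path-head-Notation : ∀ {α β δ} → Path R α β δ → Notation α
    Path-head-Notation [ nα ] = nα
    Path-head-Notation (nα ∷⟨ _ ⟩ _) = nα

    PathWith⇒Path : ∀ {α β} δ → PathWith R α β δ → Path R α β δ
    PathWith⇒Path [] (() , _)
    PathWith⇒Path (a ∷ []) (_ , notations , refl , refl , _) = [ notations 0 a refl ]
    PathWith⇒Path (a ∷ b ∷ δ) (_ , notations , refl , last , steps) =
      notations 0 a refl ∷⟨ steps 0 a b refl refl ⟩
      PathWith⇒Path (b ∷ δ) (s≤s z≤n , (λ n → notations (suc n)) , refl , last , (λ n → steps (suc n)))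

    Path⇒PathWith : ∀ {α β δ} → Path R α β δ → PathWith R α β δ
    Path⇒PathWith [ nα ] =
      s≤s z≤n , (λ { zero _ refl → nα }) , refl , refl , λ { zero _ _ _ () ; (suc _) _ _ () _ }
    Path⇒PathWith {α} (_∷⟨_⟩_ {δ = δ} nα r p) with Path⇒PathWith p
    ... | 0<|δ| , notations , head , last , steps =
      s≤s z≤n , notations′ , refl , trans (nth-last δ 0<|δ|) last , steps′
      where
        nth-last : ∀ δ → 0 < length δ → nth (α ∷ δ) (length δ) ≡ nth δ (length δ ∸ 1)
        nth-last (_ ∷ _) _ = refl

        notations′ : ∀ n y → nth (α ∷ δ) n ≡ just y → Notation y
        notations′ zero _ refl = nα
        notations′ (suc n) = notations n

        steps′ : ∀ n y z → nth (α ∷ δ) n ≡ just y → nth (α ∷ δ) (suc n) ≡ just z → R y z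
        steps′ zero _ z refl δ₀≡z = subst (R α) (just-injective (trans (sym head) δ₀≡z)) r
        steps′ (suc n) = steps n

    mutual
      Path-descends : (∀ {x y} → R x y → Step x y) → ∀ {α β δ} → Path R α β δ → β ≤O α
      Path-descends R⊆Step [ _ ] = inj₂ refl
      Path-descends R⊆Step (nα ∷⟨ r ⟩ p) = inj₁ (Path-strictly-descends R⊆Step nα r p)

      Path-strictly-descends : (∀ {x y} → R x y → Step x y) → ∀ {α x β δ} →
                               Notation α → R α x → Path R x β δ → β <O α
      Path-strictly-descends R⊆Step nα r p =
        ≤O-<O-trans (Path-descends R⊆Step p) (Step⇒<O (R⊆Step r) nα (Path-head-Notation p))

  MinPath-exists : ExcludedMiddle 0ℓ → ∀ {α β} → Acc _<O_ α → Notation α → β ≤O α →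
                   ∃ (Path (MinStep β) α β)
  MinPath-exists em _ nα (inj₂ refl) = _ , [ nα ]
  MinPath-exists em (acc smaller) nα (inj₁ β<α) with MinStep-exists em nα β<α
  ... | γ , s , γ<α , β≤γ with MinPath-exists em (smaller γ<α) (<O⇒Notationˡ γ<α) β≤γ
  ... | δ , p = _ , nα ∷⟨ s ⟩ p

  MinPath-unique : ∀ {α β δ δ′} → Path (MinStep β) α β δ → Path (MinStep β) α β δ′ → δ ≡ δ′
  MinPath-unique [ _ ] [ _ ] = refl
  MinPath-unique [ _ ] (nα ∷⟨ s ⟩ p) = ⊥-elim (<O-irrefl (Path-strictly-descends MinStep⇒Step nα s p))
  MinPath-unique (nα ∷⟨ s ⟩ p) [ _ ] = ⊥-elim (<O-irrefl (Path-strictly-descends MinStep⇒Step nα s p))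
  MinPath-unique (nα ∷⟨ s ⟩ p) (_ ∷⟨ s′ ⟩ p′) with MinStep-functional s s′
  ... | refl = cong (_ ∷_) (MinPath-unique p p′)

  MinPath-prefix : ∀ {α β δ} → Path (MinStep β) α β δ → ∀ k → suc k ≤ length δ →
                   ∃ λ x → nth δ k ≡ just x × β ≤O x × Path (MinStep x) α x (take (suc k) δ)
  MinPath-prefix [ nα ] zero _ = _ , refl , inj₂ refl , [ nα ]
  MinPath-prefix p@(nα ∷⟨ _ ⟩ _) zero _ = _ , refl , Path-descends MinStep⇒Step p , [ nα ]
  MinPath-prefix [ _ ] (suc k) (s≤s ())
  MinPath-prefix (nα ∷⟨ s ⟩ p) (suc k) (s≤s k<|δ|) with MinPath-prefix p k k<|δ|
  ... | x , δk≡x , β≤x , q =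
    x , δk≡x , β≤x , nα ∷⟨ MinStep-retarget s β≤x (Path-descends MinStep⇒Step q) ⟩ q

lemmaB2 : (E : Enumeration) → ExcludedMiddle 0ℓ →
    let open Kleene E in
    ∀ α β → Notation α → Notation β → β ≤O α →
    Σ (List ℕ) (λ δ → MinOPath α β δ)
    × (∀ δ δ' → MinOPath α β δ → MinOPath α β δ' → δ ≡ δ')
    × (∀ δ → MinOPath α β δ → ∀ n → 0 < n → n ≤ length δ →
    ∃ λ x → nth δ (n ∸ 1) ≡ just x × MinOPath α x (take n δ))
lemmaB2 E em α β nα _ β≤α =
    map₂ Path⇒PathWith (MinPath-exists em (Notation⇒Acc nα) nα β≤α)
  , (λ δ δ′ p p′ → MinPath-unique (PathWith⇒Path δ p) (PathWith⇒Path δ′ p′))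
  , prefix
  where
    open Kleene E
    open Properties E

    prefix : ∀ δ → MinOPath α β δ → ∀ n → 0 < n → n ≤ length δ →
             ∃ λ x → nth δ (n ∸ 1) ≡ just x × MinOPath α x (take n δ)
    prefix δ p (suc k) _ n≤|δ| with MinPath-prefix (PathWith⇒Path δ p) k n≤|δ|
    ... | x , δk≡x , _ , q = x , δk≡x , Path⇒PathWith q
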